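{- Let $\mathcal{T}$ be a PQ-tree over a finite set $Y$. Then $\alpha(\mathcal{T})$ is a hierarchy over $Y$ if and only if every non-leaf vertex of $\mathcal{T}$ is a P-vertex. In that case, letting $\mathcal{T}'$ be the underlying rooted $Y$-tree (forgetting orderings and labels), $\alpha(\mathcal{T})=\{H_v\mid v\text{ a vertex of }\mathcal{T}'\}$, where $H_v$ is the set of $y\in Y$ whose leaf lies at or below $v$.
   Context: A rooted $Y$-tree is a finite rooted tree whose leaves are bijectively labelled by $Y$. A PQ-tree over $Y$ is a rooted $Y$-tree in which every non-leaf vertex carries a linear ordering of its children and a label P or Q, where vertices with fewer than three children must be labelled P. Two PQ-trees are equivalent if one can be obtained from the other by a sequence of moves, each either permuting arbitrarily the order of the children of a P-vertex or reversing the order of the children of a Q-vertex. The frontier of a PQ-tree is the linear order on $Y$ obtained by reading the leaves from left to right when the children of each vertex are drawn in their given order; $\mathrm{con}(\mathcal{T})$ is the set of frontiers of PQ-trees equivalent to $\mathcal{T}$. A subset $I\subseteq Y$ is an interval for a linear order $\prec$ if $I=\{t\mid a\preceq t\preceq b\}$ for some $a,b\in Y$. $\alpha(\mathcal{T})$ is the set of all $I\subseteq Y$ that are intervals with respect to every order in $\mathrm{con}(\mathcal{T})$. A hierarchy over $Y$ is a family $\mathcal{H}$ of subsets of $Y$ with $Y\in\mathcal{H}$, $\{y\}\in\mathcal{H}$ for all $y$, and $A\cap B\in\{\emptyset,A,B\}$ for all $A,B\in\mathcal{H}$. -}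

module Defs where

open import Data.Nat using (ℕ; _≤_)
open import Data.Fin using (Fin)
open import Data.Fin.Subset using (Subset; ⁅_⁆; _∪_; _∩_; ⊥; ⊤)
import Data.Fin.Subset as S
open import Data.List using (List; []; _∷_; _++_; length; reverse; allFin)
open import Data.List.Membership.Propositional using (_∈_)
open import Data.List.Relation.Unary.All using (All)
open import Data.List.Relation.Binary.Permutation.Propositional using (_↭_)
open import Relation.Binary.Construct.Closure.ReflexiveTransitive using (Star)
open import Relation.Binary.PropositionalEquality using (_≡_)
open import Data.Product using (_×_; ∃-syntax)
open import Data.Sum using (_⊎_)
open import Function.Bundles using (_⇔_)

-- Y is represented by Fin n.

data Label : Set where
  P Q : Label

data PQTree (n : ℕ) : Set where
  leaf : Fin n → PQTree n
  node : Label → List (PQTree n) → PQTree n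

module _ {n : ℕ} where

  mutual
    frontier : PQTree n → List (Fin n)
    frontier (leaf y) = y ∷ []
    frontier (node _ ts) = frontiers ts

    frontiers : List (PQTree n) → List (Fin n)
    frontiers [] = []
    frontiers (t ∷ ts) = frontier t ++ frontiers ts

  -- local well-formedness: non-leaf vertices have at least one child
  -- (otherwise they would be leaves), Q-vertices have at least 3 children
  data WF : PQTree n → Set where
    leaf  : ∀ y → WF (leaf y)
    pnode : ∀ ts → 1 ≤ length ts → All WF ts → WF (node P ts)
    qnode : ∀ ts → 3 ≤ length ts → All WF ts → WF (node Q ts)

  -- a PQ-tree over Y: well-formed and leaves bijectively labelled by Y
  IsPQTree : PQTree n → Set
  IsPQTree T = WF T × (frontier T ↭ allFin n)

  data Move : PQTree n → PQTree n → Set where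
    permP : ∀ ts us → ts ↭ us → Move (node P ts) (node P us)
    revQ  : ∀ ts → Move (node Q ts) (node Q (reverse ts))
    deep  : ∀ l xs t u ys → Move t u →
            Move (node l (xs ++ t ∷ ys)) (node l (xs ++ u ∷ ys))

  _≈PQ_ : PQTree n → PQTree n → Set
  _≈PQ_ = Star Move

  -- the linear order given by a list (without repetitions): a ⪯ t in ℓ
  _⟨_⟩⪯_ : Fin n → List (Fin n) → Fin n → Set
  a ⟨ ℓ ⟩⪯ t = ∃[ xs ] ∃[ ys ] (ℓ ≡ xs ++ a ∷ ys × t ∈ a ∷ ys)

  -- I is an interval {t | a ⪯ t ⪯ b} with a ⪯ b (non-empty intervals)
  IsInterval : List (Fin n) → Subset n → Set
  IsInterval ℓ I = ∃[ a ] ∃[ b ] (a ⟨ ℓ ⟩⪯ b ×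
                     (∀ t → (t S.∈ I) ⇔ (a ⟨ ℓ ⟩⪯ t × t ⟨ ℓ ⟩⪯ b)))

  InCon : PQTree n → List (Fin n) → Set
  InCon T ℓ = ∃[ T' ] (T ≈PQ T' × frontier T' ≡ ℓ)

  InAlpha : PQTree n → Subset n → Set
  InAlpha T I = ∀ ℓ → InCon T ℓ → IsInterval ℓ I

  Hierarchy : (Subset n → Set) → Set
  Hierarchy H = H ⊤ × (∀ y → H ⁅ y ⁆) ×
    (∀ A B → H A → H B → (A ∩ B ≡ ⊥) ⊎ (A ∩ B ≡ A) ⊎ (A ∩ B ≡ B))

  data AllP : PQTree n → Set where
    leaf : ∀ y → AllP (leaf y)
    node : ∀ ts → All AllP ts → AllP (node P ts)

  -- v is (the subtree rooted at) a vertex of T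
  data VertexOf : PQTree n → PQTree n → Set where
    here  : ∀ T → VertexOf T T
    there : ∀ v t l ts → VertexOf v t → t ∈ ts → VertexOf v (node l ts)

  leafSet : List (Fin n) → Subset n
  leafSet [] = ⊥
  leafSet (y ∷ ys) = ⁅ y ⁆ ∪ leafSet ys

  H : PQTree n → Subset n
  H v = leafSet (frontier v)

module Submission where

-- Every con(T)-order is the frontier of a tree equivalent to T, and moves only
-- permute frontiers, so the frontier stays duplicate-free and H_v is unchanged.
-- (1) Blocks -- leaf sets of a vertex, or of two adjacent children of a
--     Q-vertex -- survive every move and always occupy a contiguous segment of
--     the frontier; hence every non-empty block lies in α(T).
-- (2) A Q-vertex with children c₁ c₂ c₃ … yields the blocks H c₁ ∪ H c₂ and
--     H c₂ ∪ H c₃, which overlap properly: α(T) is not a hierarchy.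
-- (3) If all vertices are P-vertices, induction shows every I ∈ α(T) is some
--     H_v: if I fits inside one child, restrict to that child; otherwise I meets
--     two children, and rearranging the children around any leaf z puts z
--     between two members of I, so I is the whole leaf set.
-- (4) Vertex leaf sets are nested or disjoint, so they form a hierarchy.

open import Data.Nat using (ℕ; s≤s)
open import Data.Empty using (⊥; ⊥-elim)
open import Data.Product using (_×_; _,_; ∃-syntax; proj₁; proj₂)
open import Data.Sum using (_⊎_; inj₁; inj₂)
open import Function.Bundles using (_⇔_; mk⇔; Equivalence)
open import Relation.Nullary using (¬_; yes; no)
open import Relation.Nullary.Decidable using (_×-dec_; ¬?; decidable-stable)
open import Relation.Binary.PropositionalEquality
open import Relation.Binary.Construct.Closure.ReflexiveTransitive using (ε; _◅_)

open import Data.List using (List; []; _∷_; _++_; reverse)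
open import Data.List.Properties using (++-assoc; ++-identityʳ; ∷-injective; reverse-++; unfold-reverse)
open import Data.List.Membership.Propositional using (_∈_)
open import Data.List.Membership.Propositional.Properties using (∈-++⁺ˡ; ∈-++⁺ʳ; ∈-++⁻; ∈-∃++; ∈-allFin)
open import Data.List.Relation.Unary.Any using (here; there)
open import Data.List.Relation.Unary.All using (All; []; _∷_; lookup)
import Data.List.Relation.Unary.All.Properties as All
open import Data.List.Relation.Unary.AllPairs using ([]; _∷_)
open import Data.List.Relation.Unary.Unique.Propositional using (Unique)
open import Data.List.Relation.Unary.Unique.Propositional.Properties using (allFin⁺)
open import Data.List.Relation.Binary.Pointwise using (Pointwise; _∷_)
import Data.List.Relation.Binary.Pointwise as Pointwise
open import Data.List.Relation.Binary.Permutation.Propositional using (_↭_; ↭-refl; ↭-sym; ↭-trans; prep; swap; ↭⇒↭ₛ)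
import Data.List.Relation.Binary.Permutation.Propositional as Perm
open import Data.List.Relation.Binary.Permutation.Propositional.Properties using (∈-resp-↭; ++⁺ˡ; ++⁺ʳ; ++⁺; ++-comm; shifts; ↭-reverse)
import Data.List.Relation.Binary.Permutation.Setoid.Properties as PermSetoid

open import Data.Fin using (Fin)
open import Data.Fin.Properties using (any?)
open import Data.Fin.Subset using (Subset; ⁅_⁆; _∩_; ⊤; _⊆_) renaming (_∈_ to _∈ₛ_; _∉_ to _∉ₛ_; ⊥ to ∅)
open import Data.Fin.Subset.Properties using (x∈p∪q⁻; x∈p∪q⁺; x∈⁅x⁆; x∈⁅y⁆⇒x≡y; ∉⊥; ∈⊤; ⊆-antisym; ∪-identityʳ; x∈p∩q⁺; p∩q⊆p; p∩q⊆q; _∈?_)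

open import Defs

module _ {A : Set} where

  unique-suffix : ∀ xs {ys : List A} → Unique (xs ++ ys) → Unique ys
  unique-suffix [] u = u
  unique-suffix (x ∷ xs) (_ ∷ u) = unique-suffix xs u

  unique-prefix : ∀ xs {ys : List A} → Unique (xs ++ ys) → Unique xs
  unique-prefix [] u = []
  unique-prefix (x ∷ xs) (x∉ ∷ u) = All.++⁻ˡ xs x∉ ∷ unique-prefix xs u

  unique-disjoint : ∀ xs {ys : List A} {x} → Unique (xs ++ ys) → x ∈ xs → x ∈ ys → ⊥
  unique-disjoint (x ∷ xs) (x∉ ∷ _) (here refl) x∈ys = lookup x∉ (∈-++⁺ʳ xs x∈ys) refl
  unique-disjoint (x ∷ xs) (_ ∷ u) (there x∈xs) x∈ys = unique-disjoint xs u x∈xs x∈ys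

  split-unique : ∀ xs {xs′ ys ys′ : List A} {a} → Unique (xs ++ a ∷ ys) →
                 xs ++ a ∷ ys ≡ xs′ ++ a ∷ ys′ → xs ≡ xs′ × ys ≡ ys′
  split-unique [] {[]} _ eq = refl , proj₂ (∷-injective eq)
  split-unique [] {x ∷ xs′} (a∉ ∷ _) eq with ∷-injective eq
  ... | refl , ys≡ = ⊥-elim (lookup a∉ (subst (_ ∈_) (sym ys≡) (∈-++⁺ʳ xs′ (here refl))) refl)
  split-unique (x ∷ xs) {[]} (x∉ ∷ _) eq with ∷-injective eq
  ... | refl , _ = ⊥-elim (lookup x∉ (∈-++⁺ʳ xs (here refl)) refl)
  split-unique (x ∷ xs) {y ∷ xs′} (_ ∷ u) eq with ∷-injective eq
  ... | refl , eq′ with split-unique xs u eq′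
  ... | refl , ys≡ = refl , ys≡

  _⟨_⟩≤_ : A → List A → A → Set
  a ⟨ ℓ ⟩≤ t = ∃[ xs ] ∃[ ys ] (ℓ ≡ xs ++ a ∷ ys × t ∈ a ∷ ys)

  ≤-memˡ : ∀ {ℓ : List A} {a t} → a ⟨ ℓ ⟩≤ t → a ∈ ℓ
  ≤-memˡ (xs , _ , refl , _) = ∈-++⁺ʳ xs (here refl)

  ≤-memʳ : ∀ {ℓ : List A} {a t} → a ⟨ ℓ ⟩≤ t → t ∈ ℓ
  ≤-memʳ (xs , _ , refl , t∈) = ∈-++⁺ʳ xs t∈

  ≤-refl : ∀ {ℓ : List A} {a} → a ∈ ℓ → a ⟨ ℓ ⟩≤ a
  ≤-refl a∈ℓ with ∈-∃++ a∈ℓ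
  ... | xs , ys , eq = xs , ys , eq , here refl

  ≤-head : ∀ {z : A} {zs t} → t ∈ z ∷ zs → z ⟨ z ∷ zs ⟩≤ t
  ≤-head {zs = zs} t∈ = [] , zs , refl , t∈

  ≤-weakenˡ : ∀ xs {ys : List A} {a t} → a ⟨ ys ⟩≤ t → a ⟨ xs ++ ys ⟩≤ t
  ≤-weakenˡ xs {a = a} (p , q , refl , t∈) = xs ++ p , q , sym (++-assoc xs p (a ∷ q)) , t∈

  ≤-weakenʳ : ∀ {xs : List A} ys {a t} → a ⟨ xs ⟩≤ t → a ⟨ xs ++ ys ⟩≤ t
  ≤-weakenʳ ys {a = a} (p , q , refl , t∈) = p , q ++ ys , ++-assoc p (a ∷ q) ys , ∈-++⁺ˡ t∈

  ≤-across : ∀ {xs ys : List A} {a t} → a ∈ xs → t ∈ ys → a ⟨ xs ++ ys ⟩≤ t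
  ≤-across {ys = ys} {a} a∈xs t∈ys with ∈-∃++ a∈xs
  ... | p , q , refl = p , q ++ ys , ++-assoc p (a ∷ q) ys , there (∈-++⁺ʳ q t∈ys)

  ≤-total : ∀ {ℓ : List A} {a t} → a ∈ ℓ → t ∈ ℓ → a ⟨ ℓ ⟩≤ t ⊎ t ⟨ ℓ ⟩≤ a
  ≤-total {x ∷ xs} (here refl) t∈ = inj₁ (≤-head t∈)
  ≤-total {x ∷ xs} (there a∈) (here refl) = inj₂ (≤-head (there a∈))
  ≤-total {x ∷ xs} (there a∈) (there t∈) with ≤-total a∈ t∈
  ... | inj₁ a≤t = inj₁ (≤-weakenˡ (x ∷ []) a≤t)
  ... | inj₂ t≤a = inj₂ (≤-weakenˡ (x ∷ []) t≤a)

  ≤-suffix : ∀ {ℓ : List A} xs {ys b c} → Unique ℓ → ℓ ≡ xs ++ b ∷ ys → b ⟨ ℓ ⟩≤ c → c ∈ b ∷ ys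
  ≤-suffix xs u refl (_ , _ , eq , c∈) with split-unique xs u eq
  ... | _ , refl = c∈

  ≤-trans : ∀ {ℓ : List A} {a b c} → Unique ℓ → a ⟨ ℓ ⟩≤ b → b ⟨ ℓ ⟩≤ c → a ⟨ ℓ ⟩≤ c
  ≤-trans {a = a} {b} {c} u (xs , ys , refl , b∈) b≤c with ∈-∃++ b∈
  ... | p , q , a∷ys≡ = xs , ys , refl , subst (c ∈_) (sym a∷ys≡) (∈-++⁺ʳ p c∈b∷q)
    where
      c∈b∷q : c ∈ b ∷ q
      c∈b∷q = ≤-suffix (xs ++ p) u (trans (cong (xs ++_) a∷ys≡) (sym (++-assoc xs p (b ∷ q)))) b≤c

  ≤-antisym : ∀ {ℓ : List A} {a t} → Unique ℓ → a ⟨ ℓ ⟩≤ t → t ⟨ ℓ ⟩≤ a → a ≡ t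
  ≤-antisym u (_ , _ , refl , here refl) _ = refl
  ≤-antisym {a = a} {t} u (xs , ys , refl , there t∈ys) t≤a with ∈-∃++ t∈ys
  ... | p , q , refl with unique-suffix xs u
  ... | a∉ys ∷ _ = ⊥-elim (lookup a∉ys (∈-++⁺ʳ p a∈t∷q) refl)
    where
      a∈t∷q : a ∈ t ∷ q
      a∈t∷q = ≤-suffix (xs ++ a ∷ p) u (sym (++-assoc xs (a ∷ p) (t ∷ q))) t≤a

  ≤-prefix : ∀ xs {ys : List A} {a t} → Unique (xs ++ ys) → a ∈ xs → t ∈ xs →
             a ⟨ xs ++ ys ⟩≤ t → a ⟨ xs ⟩≤ t
  ≤-prefix xs {ys} u a∈ t∈ a≤t with ≤-total a∈ t∈
  ... | inj₁ a≤t′ = a≤t′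
  ... | inj₂ t≤a with ≤-antisym u a≤t (≤-weakenʳ ys t≤a)
  ... | refl = ≤-refl a∈

  ≤-greatest : ∀ (z : A) zs → ∃[ b ] (b ∈ z ∷ zs × (∀ {t} → t ∈ z ∷ zs → t ⟨ z ∷ zs ⟩≤ b))
  ≤-greatest z [] = z , here refl , λ { (here refl) → ≤-refl (here refl) }
  ≤-greatest z (z′ ∷ zs) with ≤-greatest z′ zs
  ... | b , b∈ , greatest =
    b , there b∈ , λ { (here refl) → ≤-head (there b∈) ; (there t∈) → ≤-weakenˡ (z ∷ []) (greatest t∈) }

  Infix : List A → List A → Set
  Infix zs ℓ = ∃[ xs ] ∃[ ys ] (ℓ ≡ xs ++ zs ++ ys)

  infix-refl : ∀ ℓ → Infix ℓ ℓ
  infix-refl ℓ = [] , [] , sym (++-identityʳ ℓ)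

  infix-suffix : ∀ xs (ℓ : List A) → Infix ℓ (xs ++ ℓ)
  infix-suffix xs ℓ = xs , [] , sym (cong (xs ++_) (++-identityʳ ℓ))

  infix-trans : ∀ {as bs cs : List A} → Infix as bs → Infix bs cs → Infix as cs
  infix-trans {as} (xs , ys , refl) (xs′ , ys′ , refl) = xs′ ++ xs , ys ++ ys′ , reassociate
    where
      open ≡-Reasoning
      reassociate : xs′ ++ (xs ++ as ++ ys) ++ ys′ ≡ (xs′ ++ xs) ++ as ++ ys ++ ys′
      reassociate = begin
        xs′ ++ (xs ++ as ++ ys) ++ ys′  ≡⟨ cong (xs′ ++_) (++-assoc xs (as ++ ys) ys′) ⟩
        xs′ ++ xs ++ (as ++ ys) ++ ys′  ≡⟨ cong (λ w → xs′ ++ xs ++ w) (++-assoc as ys ys′) ⟩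
        xs′ ++ xs ++ as ++ ys ++ ys′    ≡⟨ sym (++-assoc xs′ xs _) ⟩
        (xs′ ++ xs) ++ as ++ ys ++ ys′  ∎

  infix-mem : ∀ {zs ℓ : List A} {x} → Infix zs ℓ → x ∈ zs → x ∈ ℓ
  infix-mem (xs , _ , refl) x∈ = ∈-++⁺ʳ xs (∈-++⁺ˡ x∈)

  infix-unique : ∀ {zs ℓ : List A} → Infix zs ℓ → Unique ℓ → Unique zs
  infix-unique {zs} (xs , _ , refl) u = unique-prefix zs (unique-suffix xs u)

module _ {n : ℕ} where

  leafSet⁻ : ∀ {ℓ : List (Fin n)} {t} → t ∈ₛ leafSet ℓ → t ∈ ℓ
  leafSet⁻ {[]} t∈ = ⊥-elim (∉⊥ t∈)
  leafSet⁻ {y ∷ ys} t∈ with x∈p∪q⁻ ⁅ y ⁆ (leafSet ys) t∈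
  ... | inj₁ t∈y = here (x∈⁅y⁆⇒x≡y y t∈y)
  ... | inj₂ t∈ys = there (leafSet⁻ t∈ys)

  leafSet⁺ : ∀ {ℓ : List (Fin n)} {t} → t ∈ ℓ → t ∈ₛ leafSet ℓ
  leafSet⁺ {y ∷ ys} (here refl) = x∈p∪q⁺ (inj₁ (x∈⁅x⁆ y))
  leafSet⁺ {y ∷ ys} (there t∈) = x∈p∪q⁺ (inj₂ (leafSet⁺ t∈))

  leafSet-↭ : ∀ {xs ys : List (Fin n)} → xs ↭ ys → leafSet xs ≡ leafSet ys
  leafSet-↭ p = ⊆-antisym (λ t∈ → leafSet⁺ (∈-resp-↭ p (leafSet⁻ t∈)))
                          (λ t∈ → leafSet⁺ (∈-resp-↭ (↭-sym p) (leafSet⁻ t∈)))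

  ∩-⊆ˡ : ∀ {A B : Subset n} → A ⊆ B → A ∩ B ≡ A
  ∩-⊆ˡ {A} {B} A⊆B = ⊆-antisym (p∩q⊆p A B) (λ x∈A → x∈p∩q⁺ (x∈A , A⊆B x∈A))

  ∩-⊆ʳ : ∀ {A B : Subset n} → B ⊆ A → A ∩ B ≡ B
  ∩-⊆ʳ {A} {B} B⊆A = ⊆-antisym (p∩q⊆q A B) (λ x∈B → x∈p∩q⁺ (B⊆A x∈B , x∈B))

  ∩-disjoint : ∀ {A B : Subset n} → (∀ {x} → x ∈ₛ A → x ∈ₛ B → ⊥) → A ∩ B ≡ ∅
  ∩-disjoint {A} {B} disjoint =
    ⊆-antisym (λ x∈ → ⊥-elim (disjoint (p∩q⊆p A B x∈) (p∩q⊆q A B x∈))) (λ x∈∅ → ⊥-elim (∉⊥ x∈∅))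

  ∩≡ˡ⇒⊆ : ∀ {A B : Subset n} → A ∩ B ≡ A → A ⊆ B
  ∩≡ˡ⇒⊆ {A} {B} e x∈A = p∩q⊆q A B (subst (_ ∈ₛ_) (sym e) x∈A)

  ∩≡ʳ⇒⊆ : ∀ {A B : Subset n} → A ∩ B ≡ B → B ⊆ A
  ∩≡ʳ⇒⊆ {A} {B} e x∈B = p∩q⊆p A B (subst (_ ∈ₛ_) (sym e) x∈B)

  ∩≡∅⇒disjoint : ∀ {A B : Subset n} {x} → A ∩ B ≡ ∅ → x ∈ₛ A → x ∈ₛ B → ⊥
  ∩≡∅⇒disjoint e x∈A x∈B = ∉⊥ (subst (_ ∈ₛ_) e (x∈p∩q⁺ (x∈A , x∈B)))

  ⊆-or-witness : ∀ (A B : Subset n) → A ⊆ B ⊎ ∃[ x ] (x ∈ₛ A × x ∉ₛ B)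
  ⊆-or-witness A B with any? (λ x → (x ∈? A) ×-dec ¬? (x ∈? B))
  ... | yes witness = inj₂ witness
  ... | no none = inj₁ λ {x} x∈A → decidable-stable (x ∈? B) (λ x∉B → none (x , x∈A , x∉B))

  hierarchy-resp : ∀ {X Y : Subset n → Set} → (∀ I → X I ⇔ Y I) → Hierarchy Y → Hierarchy X
  hierarchy-resp {X} {Y} X⇔Y (top , singletons , nested) =
    from top , (λ y → from (singletons y)) , λ A B A∈ B∈ → nested A B (to A∈) (to B∈)
    where
      to : ∀ {I} → X I → Y I
      to = Equivalence.to (X⇔Y _)
      from : ∀ {I} → Y I → X I
      from = Equivalence.from (X⇔Y _)

  interval-⊆ : ∀ {ℓ : List (Fin n)} {I t} → IsInterval ℓ I → t ∈ₛ I → t ∈ ℓ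
  interval-⊆ (_ , _ , _ , I⇔) t∈I = ≤-memʳ (proj₁ (Equivalence.to (I⇔ _) t∈I))

  interval-nonempty : ∀ {ℓ : List (Fin n)} {I} → IsInterval ℓ I → ∃[ a ] (a ∈ₛ I)
  interval-nonempty (a , _ , a≤b , I⇔) = a , Equivalence.from (I⇔ a) (≤-refl (≤-memˡ a≤b) , a≤b)

  interval-convex : ∀ {ℓ : List (Fin n)} {I x y z} → Unique ℓ → IsInterval ℓ I →
    x ∈ₛ I → y ∈ₛ I → x ⟨ ℓ ⟩≤ z → z ⟨ ℓ ⟩≤ y → z ∈ₛ I
  interval-convex u (_ , _ , _ , I⇔) x∈I y∈I x≤z z≤y =
    Equivalence.from (I⇔ _) (≤-trans u (proj₁ (Equivalence.to (I⇔ _) x∈I)) x≤z ,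
                             ≤-trans u z≤y (proj₂ (Equivalence.to (I⇔ _) y∈I)))

  infix-interval : ∀ xs z zs ys → Unique (xs ++ (z ∷ zs) ++ ys) →
    IsInterval (xs ++ (z ∷ zs) ++ ys) (leafSet (z ∷ zs))
  infix-interval xs z zs ys u with ≤-greatest z zs
  ... | b , b∈ , greatest = z , b , embed (≤-head b∈) , λ t → mk⇔ (between t) (inside t)
    where
      ℓ : List (Fin n)
      ℓ = xs ++ (z ∷ zs) ++ ys
      embed : ∀ {a t} → a ⟨ z ∷ zs ⟩≤ t → a ⟨ ℓ ⟩≤ t
      embed a≤t = ≤-weakenˡ xs (≤-weakenʳ ys a≤t)
      between : ∀ t → t ∈ₛ leafSet (z ∷ zs) → z ⟨ ℓ ⟩≤ t × t ⟨ ℓ ⟩≤ b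
      between t t∈ = embed (≤-head (leafSet⁻ t∈)) , embed (greatest (leafSet⁻ t∈))
      inside : ∀ t → z ⟨ ℓ ⟩≤ t × t ⟨ ℓ ⟩≤ b → t ∈ₛ leafSet (z ∷ zs)
      inside t (z≤t , t≤b) with ∈-++⁻ xs (≤-memʳ z≤t)
      ... | inj₁ t∈xs with ≤-antisym u z≤t (≤-across t∈xs (here refl))
      ...   | refl = leafSet⁺ {ℓ = z ∷ zs} (here refl)
      inside t (z≤t , t≤b) | inj₂ t∈rest with ∈-++⁻ (z ∷ zs) t∈rest
      ... | inj₁ t∈zs = leafSet⁺ t∈zs
      ... | inj₂ t∈ys with ≤-antisym u t≤b (≤-weakenˡ xs (≤-across {xs = z ∷ zs} b∈ t∈ys))
      ...   | refl = leafSet⁺ {ℓ = z ∷ zs} b∈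

  prefix-interval : ∀ (xs ys : List (Fin n)) {I} → Unique (xs ++ ys) → IsInterval (xs ++ ys) I →
    (∀ {t} → t ∈ₛ I → t ∈ xs) → IsInterval xs I
  prefix-interval xs ys {I} u (a , b , a≤b , I⇔) I⊆xs =
    a , b , restrict a∈xs b∈xs a≤b , λ t → mk⇔ (between t) (inside t)
    where
      restrict : ∀ {x t} → x ∈ xs → t ∈ xs → x ⟨ xs ++ ys ⟩≤ t → x ⟨ xs ⟩≤ t
      restrict = ≤-prefix xs u
      a∈xs : a ∈ xs
      a∈xs = I⊆xs (Equivalence.from (I⇔ a) (≤-refl (≤-memˡ a≤b) , a≤b))
      b∈xs : b ∈ xs
      b∈xs = I⊆xs (Equivalence.from (I⇔ b) (a≤b , ≤-refl (≤-memʳ a≤b)))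
      between : ∀ t → t ∈ₛ I → a ⟨ xs ⟩≤ t × t ⟨ xs ⟩≤ b
      between t t∈I with Equivalence.to (I⇔ t) t∈I
      ... | a≤t , t≤b = restrict a∈xs (I⊆xs t∈I) a≤t , restrict (I⊆xs t∈I) b∈xs t≤b
      inside : ∀ t → a ⟨ xs ⟩≤ t × t ⟨ xs ⟩≤ b → t ∈ₛ I
      inside t (a≤t , t≤b) = Equivalence.from (I⇔ t) (≤-weakenʳ ys a≤t , ≤-weakenʳ ys t≤b)

  unique-↭ : ∀ {xs ys : List (Fin n)} → xs ↭ ys → Unique xs → Unique ys
  unique-↭ p = PermSetoid.Unique-resp-↭ (setoid (Fin n)) (↭⇒↭ₛ p)

  frontiers-++ : ∀ (xs ys : List (PQTree n)) → frontiers (xs ++ ys) ≡ frontiers xs ++ frontiers ys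
  frontiers-++ [] ys = refl
  frontiers-++ (x ∷ xs) ys rewrite frontiers-++ xs ys = sym (++-assoc (frontier x) (frontiers xs) (frontiers ys))

  frontiers-↭ : ∀ {ts us : List (PQTree n)} → ts ↭ us → frontiers ts ↭ frontiers us
  frontiers-↭ Perm.refl = ↭-refl
  frontiers-↭ (prep t p) = ++⁺ˡ (frontier t) (frontiers-↭ p)
  frontiers-↭ (swap t u p) =
    ↭-trans (++⁺ˡ (frontier t) (++⁺ˡ (frontier u) (frontiers-↭ p))) (shifts (frontier t) (frontier u))
  frontiers-↭ (Perm.trans p q) = ↭-trans (frontiers-↭ p) (frontiers-↭ q)

  move-↭ : ∀ {t u : PQTree n} → Move t u → frontier t ↭ frontier u
  move-↭ (permP _ _ p) = frontiers-↭ p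
  move-↭ (revQ ts) = frontiers-↭ (↭-sym (↭-reverse ts))
  move-↭ (deep _ xs t u ys m) rewrite frontiers-++ xs (t ∷ ys) | frontiers-++ xs (u ∷ ys) =
    ++⁺ˡ (frontiers xs) (++⁺ʳ (frontiers ys) (move-↭ m))

  equiv-↭ : ∀ {T T′ : PQTree n} → T ≈PQ T′ → frontier T ↭ frontier T′
  equiv-↭ ε = ↭-refl
  equiv-↭ (m ◅ ms) = ↭-trans (move-↭ m) (equiv-↭ ms)

  equiv-unique : ∀ {T T′ : PQTree n} → T ≈PQ T′ → Unique (frontier T) → Unique (frontier T′)
  equiv-unique T≈T′ = unique-↭ (equiv-↭ T≈T′)

  equiv-H : ∀ {T T′ : PQTree n} → T ≈PQ T′ → H T ≡ H T′
  equiv-H T≈T′ = leafSet-↭ (equiv-↭ T≈T′)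

  unique-frontier : ∀ {T : PQTree n} → IsPQTree T → Unique (frontier T)
  unique-frontier (_ , fr) = unique-↭ (↭-sym fr) (allFin⁺ n)

  alpha-self : ∀ {T : PQTree n} {I} → InAlpha T I → IsInterval (frontier T) I
  alpha-self {T} α = α (frontier T) (T , ε , refl)

  child-infix : ∀ {t : PQTree n} {ts} → t ∈ ts → Infix (frontier t) (frontiers ts)
  child-infix {t} t∈ts with ∈-∃++ t∈ts
  ... | p , q , refl rewrite frontiers-++ p (t ∷ q) = frontiers p , frontiers q , refl

  vertex-infix : ∀ {v T : PQTree n} → VertexOf v T → Infix (frontier v) (frontier T)
  vertex-infix (here T) = infix-refl _
  vertex-infix (there _ _ _ _ v∈t t∈ts) = infix-trans (vertex-infix v∈t) (child-infix t∈ts)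

  H-mono : ∀ {v w : PQTree n} → VertexOf v w → H v ⊆ H w
  H-mono v∈w x∈ = leafSet⁺ (infix-mem (vertex-infix v∈w) (leafSet⁻ x∈))

  wf-nonempty : ∀ {t : PQTree n} → WF t → ∃[ x ] (x ∈ frontier t)
  wf-nonempty (leaf y) = y , here refl
  wf-nonempty (pnode (t ∷ _) _ (w ∷ _)) with wf-nonempty w
  ... | x , x∈ = x , ∈-++⁺ˡ x∈
  wf-nonempty (qnode (t ∷ _) _ (w ∷ _)) with wf-nonempty w
  ... | x , x∈ = x , ∈-++⁺ˡ x∈

  vertex-wf : ∀ {v T : PQTree n} → VertexOf v T → WF T → WF v
  vertex-wf (here _) w = w
  vertex-wf (there _ _ .P _ v∈t t∈ts) (pnode _ _ ws) = vertex-wf v∈t (lookup ws t∈ts)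
  vertex-wf (there _ _ .Q _ v∈t t∈ts) (qnode _ _ ws) = vertex-wf v∈t (lookup ws t∈ts)

  mutual
    leaf-vertex : ∀ {y} (T : PQTree n) → y ∈ frontier T → VertexOf (leaf y) T
    leaf-vertex (leaf x) (here refl) = here _
    leaf-vertex (node l ts) y∈ with leaf-vertex-child ts y∈
    ... | t , t∈ts , y∈t = there _ t l ts y∈t t∈ts

    leaf-vertex-child : ∀ {y} (ts : List (PQTree n)) → y ∈ frontiers ts →
      ∃[ t ] (t ∈ ts × VertexOf (leaf y) t)
    leaf-vertex-child (t ∷ ts) y∈ with ∈-++⁻ (frontier t) y∈
    ... | inj₁ y∈t = t , here refl , leaf-vertex t y∈t
    ... | inj₂ y∈ts with leaf-vertex-child ts y∈ts
    ...   | t′ , t′∈ts , y∈t′ = t′ , there t′∈ts , y∈t′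

  children-disjoint : ∀ {ts : List (PQTree n)} {t t′} → Unique (frontiers ts) → t ∈ ts → t′ ∈ ts →
    t ≡ t′ ⊎ (∀ {x} → x ∈ frontier t → x ∈ frontier t′ → ⊥)
  children-disjoint u (here refl) (here refl) = inj₁ refl
  children-disjoint {h ∷ _} u (here refl) (there t′∈) =
    inj₂ λ x∈h x∈t′ → unique-disjoint (frontier h) u x∈h (infix-mem (child-infix t′∈) x∈t′)
  children-disjoint {h ∷ _} u (there t∈) (here refl) =
    inj₂ λ x∈t x∈h → unique-disjoint (frontier h) u x∈h (infix-mem (child-infix t∈) x∈t)
  children-disjoint {h ∷ _} u (there t∈) (there t′∈) =
    children-disjoint (unique-suffix (frontier h) u) t∈ t′∈

  vertices-laminar : ∀ {T v w : PQTree n} → Unique (frontier T) → VertexOf v T → VertexOf w T →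
    VertexOf v w ⊎ VertexOf w v ⊎ (∀ {x} → x ∈ frontier v → x ∈ frontier w → ⊥)
  vertices-laminar u (here _) w∈T = inj₂ (inj₁ w∈T)
  vertices-laminar u v∈T (here _) = inj₁ v∈T
  vertices-laminar u (there _ _ _ _ v∈t t∈ts) (there _ _ _ _ w∈t′ t′∈ts) with children-disjoint u t∈ts t′∈ts
  ... | inj₁ refl = vertices-laminar (infix-unique (child-infix t∈ts) u) v∈t w∈t′
  ... | inj₂ disjoint =
    inj₂ (inj₂ λ x∈v x∈w → disjoint (infix-mem (vertex-infix v∈t) x∈v) (infix-mem (vertex-infix w∈t′) x∈w))

  vertex-sets-nested : ∀ {T v w : PQTree n} → Unique (frontier T) → VertexOf v T → VertexOf w T →
    (H v ∩ H w ≡ ∅) ⊎ (H v ∩ H w ≡ H v) ⊎ (H v ∩ H w ≡ H w)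
  vertex-sets-nested u v∈T w∈T with vertices-laminar u v∈T w∈T
  ... | inj₁ v∈w = inj₂ (inj₁ (∩-⊆ˡ (H-mono v∈w)))
  ... | inj₂ (inj₁ w∈v) = inj₂ (inj₂ (∩-⊆ʳ (H-mono w∈v)))
  ... | inj₂ (inj₂ disjoint) = inj₁ (∩-disjoint λ x∈v x∈w → disjoint (leafSet⁻ x∈v) (leafSet⁻ x∈w))

  vertex-sets-hierarchy : ∀ {T : PQTree n} → IsPQTree T →
    Hierarchy (λ I → ∃[ v ] (VertexOf v T × H v ≡ I))
  vertex-sets-hierarchy {T} isT@(_ , fr) = (T , here T , root-set) , singleton , nested
    where
      y∈T : ∀ y → y ∈ frontier T
      y∈T y = ∈-resp-↭ (↭-sym fr) (∈-allFin y)
      root-set : H T ≡ ⊤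
      root-set = ⊆-antisym (λ _ → ∈⊤) (λ {y} _ → leafSet⁺ (y∈T y))
      singleton : ∀ y → ∃[ v ] (VertexOf v T × H v ≡ ⁅ y ⁆)
      singleton y = leaf y , leaf-vertex T (y∈T y) , ∪-identityʳ ⁅ y ⁆
      nested : ∀ A B → ∃[ v ] (VertexOf v T × H v ≡ A) → ∃[ w ] (VertexOf w T × H w ≡ B) →
        (A ∩ B ≡ ∅) ⊎ (A ∩ B ≡ A) ⊎ (A ∩ B ≡ B)
      nested _ _ (v , v∈T , refl) (w , w∈T , refl) = vertex-sets-nested (unique-frontier isT) v∈T w∈T

  data AdjacentPair (S : Subset n) : List (PQTree n) → Set where
    adjacent : ∀ {c d ts} → leafSet (frontier c ++ frontier d) ≡ S → AdjacentPair S (c ∷ d ∷ ts)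
    later    : ∀ {t ts} → AdjacentPair S ts → AdjacentPair S (t ∷ ts)

  data Block (S : Subset n) : PQTree n → Set where
    vertex : ∀ {T} → H T ≡ S → Block S T
    q-pair : ∀ {ts} → AdjacentPair S ts → Block S (node Q ts)
    child  : ∀ {t l ts} → Block S t → t ∈ ts → Block S (node l ts)

  adjacent-frontiers : ∀ {S} {ts us : List (PQTree n)} →
    Pointwise (λ t u → frontier t ↭ frontier u) ts us → AdjacentPair S ts → AdjacentPair S us
  adjacent-frontiers (c↭ ∷ d↭ ∷ _) (adjacent e) = adjacent (trans (sym (leafSet-↭ (++⁺ c↭ d↭))) e)
  adjacent-frontiers (_ ∷ ts↭) (later a) = later (adjacent-frontiers ts↭ a)

  adjacent-++ˡ : ∀ {S} xs {ys : List (PQTree n)} → AdjacentPair S ys → AdjacentPair S (xs ++ ys)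
  adjacent-++ˡ [] a = a
  adjacent-++ˡ (x ∷ xs) a = later (adjacent-++ˡ xs a)

  adjacent-++ʳ : ∀ {S} {xs : List (PQTree n)} ys → AdjacentPair S xs → AdjacentPair S (xs ++ ys)
  adjacent-++ʳ ys (adjacent e) = adjacent e
  adjacent-++ʳ ys (later a) = later (adjacent-++ʳ ys a)

  adjacent-reverse : ∀ {S} {ts : List (PQTree n)} → AdjacentPair S ts → AdjacentPair S (reverse ts)
  adjacent-reverse (adjacent {c} {d} {ts} e) rewrite reverse-++ (c ∷ d ∷ []) ts =
    adjacent-++ˡ (reverse ts) (adjacent (trans (leafSet-↭ (++-comm (frontier d) (frontier c))) e))
  adjacent-reverse (later {t} {ts} a) rewrite unfold-reverse t ts = adjacent-++ʳ (t ∷ []) (adjacent-reverse a)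

  block-move : ∀ {S} {T T′ : PQTree n} → Move T T′ → Block S T → Block S T′
  block-move m (vertex e) = vertex (trans (sym (leafSet-↭ (move-↭ m))) e)
  block-move (permP _ _ p) (child b t∈) = child b (∈-resp-↭ p t∈)
  block-move (revQ ts) (q-pair a) = q-pair (adjacent-reverse a)
  block-move (revQ ts) (child b t∈) = child b (∈-resp-↭ (↭-sym (↭-reverse ts)) t∈)
  block-move (deep _ xs _ _ ys m) (q-pair a) =
    q-pair (adjacent-frontiers (Pointwise.++⁺ (Pointwise.refl ↭-refl) (move-↭ m ∷ Pointwise.refl ↭-refl)) a)
  block-move (deep _ xs _ _ ys m) (child b t∈) with ∈-++⁻ xs t∈
  ... | inj₁ t∈xs = child b (∈-++⁺ˡ t∈xs)
  ... | inj₂ (here refl) = child (block-move m b) (∈-++⁺ʳ xs (here refl))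
  ... | inj₂ (there t∈ys) = child b (∈-++⁺ʳ xs (there t∈ys))

  block-equiv : ∀ {S} {T T′ : PQTree n} → T ≈PQ T′ → Block S T → Block S T′
  block-equiv ε b = b
  block-equiv (m ◅ ms) b = block-equiv ms (block-move m b)

  block-lift : ∀ {S} {v T : PQTree n} → VertexOf v T → Block S v → Block S T
  block-lift (here _) b = b
  block-lift (there _ _ _ _ v∈t t∈ts) b = child (block-lift v∈t b) t∈ts

  block-infix : ∀ {S} {T : PQTree n} → Block S T → ∃[ zs ] (Infix zs (frontier T) × leafSet zs ≡ S)
  block-infix {T = T} (vertex e) = frontier T , infix-refl _ , e
  block-infix (q-pair a) = pair-infix a
    where
      pair-infix : ∀ {S ts} → AdjacentPair S ts → ∃[ zs ] (Infix zs (frontiers ts) × leafSet zs ≡ S)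
      pair-infix (adjacent {c} {d} {ts} e) =
        frontier c ++ frontier d , ([] , frontiers ts , sym (++-assoc (frontier c) (frontier d) _)) , e
      pair-infix (later {t} a) with pair-infix a
      ... | zs , zs⊑ , e = zs , infix-trans zs⊑ (infix-suffix (frontier t) _) , e
  block-infix (child b t∈) with block-infix b
  ... | zs , zs⊑ , e = zs , infix-trans zs⊑ (child-infix t∈) , e

  block-alpha : ∀ {S} {T : PQTree n} → Unique (frontier T) → Block S T → ∃[ a ] (a ∈ₛ S) → InAlpha T S
  block-alpha u b (a , a∈S) _ (T′ , T≈T′ , refl) with block-infix (block-equiv T≈T′ b)
  ... | [] , _ , refl = ⊥-elim (∉⊥ a∈S)
  ... | z ∷ zs , (xs , ys , eq) , refl =
    subst (λ ℓ → IsInterval ℓ (leafSet (z ∷ zs))) (sym eq)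
      (infix-interval xs z zs ys (subst Unique eq (equiv-unique T≈T′ u)))

  vertex-alpha : ∀ {v T : PQTree n} → WF T → Unique (frontier T) → VertexOf v T → InAlpha T (H v)
  vertex-alpha wf u v∈T with wf-nonempty (vertex-wf v∈T wf)
  ... | x , x∈v = block-alpha u (block-lift v∈T (vertex refl)) (x , leafSet⁺ x∈v)

  -- T has a Q-vertex; well-formedness gives it at least three children.
  QVertex : PQTree n → Set
  QVertex T = ∃[ c₁ ] ∃[ c₂ ] ∃[ c₃ ] ∃[ r ] VertexOf (node Q (c₁ ∷ c₂ ∷ c₃ ∷ r)) T

  mutual
    all-P-or-Q-vertex : ∀ (T : PQTree n) → WF T → AllP T ⊎ QVertex T
    all-P-or-Q-vertex (leaf y) _ = inj₁ (leaf y)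
    all-P-or-Q-vertex (node P ts) (pnode _ _ ws) with all-P-or-Q-vertex-children ts ws
    ... | inj₁ allP = inj₁ (node ts allP)
    ... | inj₂ (t , t∈ts , (c₁ , c₂ , c₃ , r , q∈t)) = inj₂ (c₁ , c₂ , c₃ , r , there _ t P ts q∈t t∈ts)
    all-P-or-Q-vertex (node Q (c₁ ∷ c₂ ∷ c₃ ∷ r)) _ = inj₂ (c₁ , c₂ , c₃ , r , here _)
    all-P-or-Q-vertex (node Q []) (qnode _ () _)
    all-P-or-Q-vertex (node Q (_ ∷ [])) (qnode _ (s≤s ()) _)
    all-P-or-Q-vertex (node Q (_ ∷ _ ∷ [])) (qnode _ (s≤s (s≤s ())) _)

    all-P-or-Q-vertex-children : ∀ (ts : List (PQTree n)) → All WF ts →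
      All AllP ts ⊎ ∃[ t ] (t ∈ ts × QVertex t)
    all-P-or-Q-vertex-children [] [] = inj₁ []
    all-P-or-Q-vertex-children (t ∷ ts) (w ∷ ws) with all-P-or-Q-vertex t w
    ... | inj₂ q = inj₂ (t , here refl , q)
    ... | inj₁ allP with all-P-or-Q-vertex-children ts ws
    ...   | inj₁ allPs = inj₁ (allP ∷ allPs)
    ...   | inj₂ (t′ , t′∈ts , q) = inj₂ (t′ , there t′∈ts , q)

  proper-overlap : ∀ {f₁ f₂ f₃ rest : List (Fin n)} {x₁ x₂ x₃} →
    Unique (f₁ ++ f₂ ++ f₃ ++ rest) → x₁ ∈ f₁ → x₂ ∈ f₂ → x₃ ∈ f₃ →
    let A = leafSet (f₁ ++ f₂) ; B = leafSet (f₂ ++ f₃) in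
    ¬ ((A ∩ B ≡ ∅) ⊎ (A ∩ B ≡ A) ⊎ (A ∩ B ≡ B))
  proper-overlap {f₁} u _ x₂∈ _ (inj₁ A∩B≡∅) =
    ∩≡∅⇒disjoint A∩B≡∅ (leafSet⁺ (∈-++⁺ʳ f₁ x₂∈)) (leafSet⁺ (∈-++⁺ˡ x₂∈))
  proper-overlap {f₁} {f₂} u x₁∈ _ _ (inj₂ (inj₁ A∩B≡A))
    with ∈-++⁻ f₂ (leafSet⁻ (∩≡ˡ⇒⊆ A∩B≡A (leafSet⁺ (∈-++⁺ˡ x₁∈))))
  ... | inj₁ x₁∈f₂ = unique-disjoint f₁ u x₁∈ (∈-++⁺ˡ x₁∈f₂)
  ... | inj₂ x₁∈f₃ = unique-disjoint f₁ u x₁∈ (∈-++⁺ʳ f₂ (∈-++⁺ˡ x₁∈f₃))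
  proper-overlap {f₁} {f₂} u _ _ x₃∈ (inj₂ (inj₂ A∩B≡B))
    with ∈-++⁻ f₁ (leafSet⁻ (∩≡ʳ⇒⊆ A∩B≡B (leafSet⁺ (∈-++⁺ʳ f₂ x₃∈))))
  ... | inj₁ x₃∈f₁ = unique-disjoint f₁ u x₃∈f₁ (∈-++⁺ʳ f₂ (∈-++⁺ˡ x₃∈))
  ... | inj₂ x₃∈f₂ = unique-disjoint f₂ (unique-suffix f₁ u) x₃∈f₂ (∈-++⁺ˡ x₃∈)

  -- Adjacent children c₁ c₂ and c₂ c₃ of a Q-vertex give blocks in α(T) that
  -- overlap properly, so α(T) is not a hierarchy.
  q-vertex-breaks-hierarchy : ∀ {T : PQTree n} → IsPQTree T → QVertex T → ¬ Hierarchy (InAlpha T)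
  q-vertex-breaks-hierarchy {T} isT@(wf , _) (c₁ , c₂ , c₃ , r , q∈T) (_ , _ , nested)
    with vertex-wf q∈T wf
  ... | qnode _ _ (w₁ ∷ w₂ ∷ w₃ ∷ _) with wf-nonempty w₁ | wf-nonempty w₂ | wf-nonempty w₃
  ... | x₁ , x₁∈ | x₂ , x₂∈ | x₃ , x₃∈ =
    proper-overlap (infix-unique (vertex-infix q∈T) u) x₁∈ x₂∈ x₃∈ (nested _ _
      (block-alpha u (block-lift q∈T (q-pair (adjacent refl))) (x₁ , leafSet⁺ (∈-++⁺ˡ x₁∈)))
      (block-alpha u (block-lift q∈T (q-pair (later (adjacent refl)))) (x₂ , leafSet⁺ (∈-++⁺ˡ x₂∈))))
    where
      u : Unique (frontier T)
      u = unique-frontier isT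

  child-of : ∀ {x} {ts : List (PQTree n)} → x ∈ frontiers ts → ∃[ c ] ∃[ r ] (ts ↭ c ∷ r × x ∈ frontier c)
  child-of {ts = t ∷ ts} x∈ with ∈-++⁻ (frontier t) x∈
  ... | inj₁ x∈t = t , ts , ↭-refl , x∈t
  ... | inj₂ x∈ts with child-of {ts = ts} x∈ts
  ...   | c , r , ts↭ , x∈c = c , t ∷ r , ↭-trans (prep t ts↭) (swap t c ↭-refl) , x∈c

  head-∈ : ∀ {ts : List (PQTree n)} {c r} → ts ↭ c ∷ r → c ∈ ts
  head-∈ p = ∈-resp-↭ (↭-sym p) (here refl)

  equiv-head : ∀ l (r : List (PQTree n)) {c c′} → c ≈PQ c′ → node l (c ∷ r) ≈PQ node l (c′ ∷ r)
  equiv-head l r ε = ε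
  equiv-head l r (m ◅ ms) = deep l [] _ _ r m ◅ equiv-head l r ms

  -- A member of α at a P-vertex that fits inside one child lies in α of that child:
  -- move the child to the front, then any equivalent of it yields an equivalent of
  -- the whole vertex, and restrict the interval to the child's prefix.
  alpha-child : ∀ {ts : List (PQTree n)} {c r I} → Unique (frontiers ts) → InAlpha (node P ts) I →
    ts ↭ c ∷ r → I ⊆ H c → InAlpha c I
  alpha-child {ts} {c} {r} {I} u α p I⊆c _ (c′ , c≈c′ , refl) =
    prefix-interval (frontier c′) (frontiers r) (equiv-unique T≈ u) (α _ (node P (c′ ∷ r) , T≈ , refl)) I⊆c′
    where
      T≈ : node P ts ≈PQ node P (c′ ∷ r)
      T≈ = permP ts (c ∷ r) p ◅ equiv-head P r c≈c′
      I⊆c′ : ∀ {t} → t ∈ₛ I → t ∈ frontier c′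
      I⊆c′ t∈I = leafSet⁻ (subst (_ ∈ₛ_) (equiv-H c≈c′) (I⊆c t∈I))

  -- At a P-vertex every rearrangement of the children realises an order in con,
  -- so members of α are convex in the frontier of each rearrangement.
  alpha-convex : ∀ {ts us : List (PQTree n)} {I x y z} → Unique (frontiers ts) →
    InAlpha (node P ts) I → ts ↭ us → x ∈ₛ I → y ∈ₛ I →
    x ⟨ frontiers us ⟩≤ z → z ⟨ frontiers us ⟩≤ y → z ∈ₛ I
  alpha-convex {ts} {us} u α p = interval-convex (equiv-unique T≈ u) (α _ (node P us , T≈ , refl))
    where
      T≈ : node P ts ≈PQ node P us
      T≈ = permP ts us p ◅ ε

  -- If I meets children c and d, it contains all of c: put c first and d second, or
  -- d first and c second, depending on which side of I's point in c the leaf lies.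
  alpha-fills-child : ∀ {ts : List (PQTree n)} {c d r I x y z} → Unique (frontiers ts) → InAlpha (node P ts) I →
    ts ↭ c ∷ d ∷ r → x ∈ₛ I → x ∈ frontier c → y ∈ₛ I → y ∈ frontier d → z ∈ frontier c → z ∈ₛ I
  alpha-fills-child {c = c} {d} {r} u α p x∈I x∈c y∈I y∈d z∈c with ≤-total x∈c z∈c
  ... | inj₁ x≤z = alpha-convex u α p x∈I y∈I (≤-weakenʳ _ x≤z) (≤-across z∈c (∈-++⁺ˡ y∈d))
  ... | inj₂ z≤x = alpha-convex u α (↭-trans p (swap c d ↭-refl)) y∈I x∈I
                     (≤-across y∈d (∈-++⁺ˡ z∈c)) (≤-weakenˡ (frontier d) (≤-weakenʳ _ z≤x))

  -- If I meets two different children, it contains every leaf of the vertex: leaves of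
  -- a third child are placed between the two.
  alpha-spans : ∀ {ts : List (PQTree n)} {ca cb r I a b} → Unique (frontiers ts) → InAlpha (node P ts) I →
    ts ↭ ca ∷ cb ∷ r → a ∈ₛ I → a ∈ frontier ca → b ∈ₛ I → b ∈ frontier cb →
    ∀ {z} → z ∈ frontiers ts → z ∈ₛ I
  alpha-spans {ts} {ca} {cb} {r} u α p a∈I a∈ca b∈I b∈cb z∈ts
    with ∈-++⁻ (frontier ca) (∈-resp-↭ (frontiers-↭ p) z∈ts)
  ... | inj₁ z∈ca = alpha-fills-child u α p a∈I a∈ca b∈I b∈cb z∈ca
  ... | inj₂ z∈rest with ∈-++⁻ (frontier cb) z∈rest
  ...   | inj₁ z∈cb = alpha-fills-child u α (↭-trans p (swap ca cb ↭-refl)) b∈I b∈cb a∈I a∈ca z∈cb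
  ...   | inj₂ z∈r with child-of z∈r
  ...     | cz , r′ , r↭ , z∈cz =
    alpha-convex u α (↭-trans p (prep ca (↭-trans (prep cb r↭) (swap cb cz ↭-refl)))) a∈I b∈I
      (≤-across a∈ca (∈-++⁺ˡ z∈cz)) (≤-weakenˡ (frontier ca) (≤-across z∈cz (∈-++⁺ˡ b∈cb)))

  VertexSetsOnly : PQTree n → Set
  VertexSetsOnly T = AllP T → Unique (frontier T) → ∀ I → InAlpha T I → ∃[ v ] (VertexOf v T × H v ≡ I)

  leaf-vertex-sets : ∀ y → VertexSetsOnly (leaf y)
  leaf-vertex-sets y _ _ I α = leaf y , here _ , ⊆-antisym H⊆I I⊆H
    where
      interval : IsInterval (y ∷ []) I
      interval = alpha-self α
      I⊆H : I ⊆ H (leaf y)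
      I⊆H t∈I = leafSet⁺ (interval-⊆ interval t∈I)
      H⊆I : H (leaf y) ⊆ I
      H⊆I t∈H with leafSet⁻ {ℓ = y ∷ []} t∈H | interval-nonempty interval
      ... | here refl | a , a∈I with interval-⊆ interval a∈I
      ...   | here refl = a∈I

  -- Pick a ∈ I in child ca. Either I ⊆ H ca and induction applies to ca, or some
  -- b ∈ I lies in another child and I is the whole leaf set of the vertex.
  node-vertex-sets : ∀ ts → All VertexSetsOnly ts → VertexSetsOnly (node P ts)
  node-vertex-sets ts ihs (node _ allP) u I α with interval-nonempty (alpha-self α)
  ... | a , a∈I with child-of (interval-⊆ (alpha-self α) a∈I)
  ... | ca , r₁ , p , a∈ca with ⊆-or-witness I (H ca)
  ... | inj₁ I⊆ca with lookup ihs (head-∈ p) (lookup allP (head-∈ p))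
                          (infix-unique (child-infix (head-∈ p)) u) I (alpha-child u α p I⊆ca)
  ...   | v , v∈ca , Hv≡I = v , there v ca P ts v∈ca (head-∈ p) , Hv≡I
  node-vertex-sets ts ihs (node _ allP) u I α | a , a∈I | ca , r₁ , p , a∈ca | inj₂ (b , b∈I , b∉ca)
    with ∈-++⁻ (frontier ca) (∈-resp-↭ (frontiers-↭ p) (interval-⊆ (alpha-self α) b∈I))
  ... | inj₁ b∈ca = ⊥-elim (b∉ca (leafSet⁺ b∈ca))
  ... | inj₂ b∈r₁ with child-of b∈r₁
  ...   | cb , r₂ , r₁↭ , b∈cb = node P ts , here _ , ⊆-antisym
    (λ z∈H → alpha-spans u α (↭-trans p (prep ca r₁↭)) a∈I a∈ca b∈I b∈cb (leafSet⁻ z∈H))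
    (λ z∈I → leafSet⁺ (interval-⊆ (alpha-self α) z∈I))

  mutual
    vertex-sets-only : ∀ T → VertexSetsOnly T
    vertex-sets-only (leaf y) = leaf-vertex-sets y
    vertex-sets-only (node P ts) = node-vertex-sets ts (vertex-sets-only-children ts)
    vertex-sets-only (node Q ts) ()

    vertex-sets-only-children : ∀ ts → All VertexSetsOnly ts
    vertex-sets-only-children [] = []
    vertex-sets-only-children (t ∷ ts) = vertex-sets-only t ∷ vertex-sets-only-children ts

lemma3p2 : ∀ {n : ℕ} (T : PQTree n) → IsPQTree T →
    (Hierarchy (InAlpha T) ⇔ AllP T) ×
    (AllP T → ∀ (I : Subset n) → InAlpha T I ⇔ (∃[ v ] (VertexOf v T × H v ≡ I)))
lemma3p2 T isT@(wf , _) = mk⇔ only-P all-P-hierarchy , alpha≡vertex-sets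
  where
    alpha≡vertex-sets : AllP T → ∀ I → InAlpha T I ⇔ (∃[ v ] (VertexOf v T × H v ≡ I))
    alpha≡vertex-sets allP I = mk⇔ (vertex-sets-only T allP (unique-frontier isT) I)
      (λ { (v , v∈T , refl) → vertex-alpha wf (unique-frontier isT) v∈T })
    all-P-hierarchy : AllP T → Hierarchy (InAlpha T)
    all-P-hierarchy allP = hierarchy-resp (alpha≡vertex-sets allP) (vertex-sets-hierarchy isT)
    only-P : Hierarchy (InAlpha T) → AllP T
    only-P hierarchy with all-P-or-Q-vertex T wf
    ... | inj₁ allP = allP
    ... | inj₂ q = ⊥-elim (q-vertex-breaks-hierarchy isT q hierarchy)
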